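{- Fix $n \geq 2r$, let $\mathcal{A}$ be an MLCIF on $\binom{[n]}{r}$, let $\mathcal{G}$ be the canonical generating family of $\mathcal{A}$, and let $k$ be the rank of $\mathcal{A}$. Then the subfamily $\mathcal{G} \cap \binom{[n]}{k}$ is left-compressed.
   Context: $\binom{[n]}{s}$ is the family of $s$-subsets of $[n]=\{1,\dots,n\}$. A family is intersecting if no two members are disjoint. For $s$-sets $A=\{a_1<\dots<a_s\}$, $B=\{b_1<\dots<b_s\}$ write $B\le A$ if $b_i\le a_i$ for all $i$; a family $\mathcal{F}$ of $s$-sets is left-compressed if $A\in\mathcal{F}$, $B\le A$ imply $B\in\mathcal{F}$. An MLCIF is a left-compressed intersecting family in $\binom{[n]}{r}$ maximal under inclusion among such families. A set $G\subseteq[n]$ is a potential generator of $\mathcal{A}$ if every $A\in\binom{[n]}{r}$ with $G\subseteq A$ lies in $\mathcal{A}$; the canonical generating family of $\mathcal{A}$ is the set of inclusion-minimal potential generators (generators), and the rank of $\mathcal{A}$ is the smallest size of a generator. -}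

module Defs where

open import Data.Nat using (ℕ)
open import Data.Bool using (Bool; true; false; T)
open import Data.Vec using ([]; _∷_)
open import Data.Fin using (Fin; zero; suc) renaming (_≤_ to _≤ᶠ_)
open import Data.Fin.Subset using (Subset; _⊆_; _∩_; Nonempty; ∣_∣)
open import Data.List using (List; []; _∷_; map)
open import Data.List.Relation.Binary.Pointwise using (Pointwise)
open import Data.Product using (_×_)
open import Relation.Binary.PropositionalEquality using (_≡_)

Family : ℕ → Set
Family n = Subset n → Bool

_∈ᶠ_ : ∀ {n} → Subset n → Family n → Set
A ∈ᶠ 𝒜 = T (𝒜 A)

elems : ∀ {n} → Subset n → List (Fin n)
elems []          = []
elems (true  ∷ p) = zero ∷ map suc (elems p)
elems (false ∷ p) = map suc (elems p)

_≼_ : ∀ {n} → Subset n → Subset n → Set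
B ≼ A = Pointwise _≤ᶠ_ (elems B) (elems A)

LeftCompressedP : ∀ {n} → (Subset n → Set) → Set
LeftCompressedP {n} P = ∀ (A B : Subset n) → P A → B ≼ A → P B

LeftCompressed : ∀ {n} → Family n → Set
LeftCompressed 𝒜 = LeftCompressedP (λ A → A ∈ᶠ 𝒜)

Uniform : ∀ {n} → ℕ → Family n → Set
Uniform {n} r 𝒜 = ∀ (A : Subset n) → A ∈ᶠ 𝒜 → ∣ A ∣ ≡ r

Intersecting : ∀ {n} → Family n → Set
Intersecting {n} 𝒜 = ∀ (A B : Subset n) → A ∈ᶠ 𝒜 → B ∈ᶠ 𝒜 → Nonempty (A ∩ B)

LCIF : ∀ {n} → ℕ → Family n → Set
LCIF r 𝒜 = Uniform r 𝒜 × LeftCompressed 𝒜 × Intersecting 𝒜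

_⊆ᶠ_ : ∀ {n} → Family n → Family n → Set
_⊆ᶠ_ {n} 𝒜 ℬ = ∀ (A : Subset n) → A ∈ᶠ 𝒜 → A ∈ᶠ ℬ

MLCIF : ∀ {n} → ℕ → Family n → Set
MLCIF {n} r 𝒜 = LCIF r 𝒜 × (∀ (ℬ : Family n) → LCIF r ℬ → 𝒜 ⊆ᶠ ℬ → ℬ ⊆ᶠ 𝒜)

PotentialGenerator : ∀ {n} → ℕ → Family n → Subset n → Set
PotentialGenerator {n} r 𝒜 G = ∀ (A : Subset n) → ∣ A ∣ ≡ r → G ⊆ A → A ∈ᶠ 𝒜

-- G is a generator: an inclusion-minimal potential generator
-- (i.e. G belongs to the canonical generating family of 𝒜)
Generator : ∀ {n} → ℕ → Family n → Subset n → Set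
Generator {n} r 𝒜 G =
  PotentialGenerator r 𝒜 G ×
  (∀ (H : Subset n) → H ⊆ G → PotentialGenerator r 𝒜 H → H ≡ G)

IsRank : ∀ {n} → ℕ → Family n → ℕ → Set
IsRank {n} r 𝒜 k =
  (Data.Product.∃ λ (G : Subset n) → Generator r 𝒜 G × ∣ G ∣ ≡ k) ×
  (∀ (G : Subset n) → Generator r 𝒜 G → k Data.Nat.≤ ∣ G ∣)

-- If G is a generator of size k and B ≼ G, then B is again a potential generator: every
-- r-set A ⊇ B is dominated (A ≼ A′) by an r-set A′ ⊇ G, obtained by keeping G and filling
-- up greedily from the right, and A′ ∈ 𝒜 gives A ∈ 𝒜 by compression.  Every potential
-- generator contains a generator and so has size ≥ k; hence B, of size k, contains no
-- smaller potential generator and is itself a generator.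
module Submission where

open import Defs
open import Data.Nat using (ℕ; _≤_; _*_)
open import Data.Fin.Subset using (∣_∣)
open import Data.Product using (_×_)
open import Relation.Binary.PropositionalEquality using (_≡_)

open import Data.Bool using (true; false)
import Data.Bool.Properties as Bool
open import Data.Empty using (⊥)
open import Data.Fin using (toℕ) renaming (suc to fsuc)
open import Data.Fin.Subset using (Subset; _⊆_; ⊤)
open import Data.Fin.Subset.Properties using (drop-∷-⊆; out⊆; in⊆in; ⊆⊤; ∣p∣≤n; p⊆q⇒∣p∣≤∣q∣)
open import Data.List using (List; []; _∷_; _++_; [_]; length; map)
open import Data.List.Properties using (++-assoc; length-++; map-∘)
open import Data.List.Relation.Binary.Pointwise using (Pointwise; []; _∷_; map⁺; map⁻)
open import Data.List.Relation.Unary.All as All using (All; []; _∷_)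
open import Data.List.Relation.Unary.All.Properties using (++⁺)
open import Data.Nat using (zero; suc; _+_; _<_; z≤n; s≤s; s≤s⁻¹; _≤?_)
open import Data.Nat.Induction using (<-wellFounded)
open import Data.Nat.Properties
  using (suc-injective; +-identityʳ; +-suc; +-comm; ≤-refl; ≤-trans; ≤-antisym; <-trans; n≤0⇒n≡0;
         n≤1+n; m≤n⇒m≤1+n; 1+n≰n; <⇒≱; ≮⇒≥; ≰⇒>; ≤∧≢⇒<)
open import Data.Product using (_,_; ∃-syntax)
open import Data.Vec using ([]; _∷_; here)
import Data.Vec.Properties as Vec
open import Function using (_on_; _∘′_)
open import Induction.WellFounded using (Acc; acc)
open import Relation.Binary.Construct.On using (wellFounded)
open import Relation.Binary.PropositionalEquality using (refl; sym; trans; cong; subst; subst₂; module ≡-Reasoning)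
open import Relation.Nullary using (Dec; yes; no; ¬_; contradiction)
open import Relation.Nullary.Decidable using (decidable-stable)

_≟_ : ∀ {m} (p q : Subset m) → Dec (p ≡ q)
_≟_ = Vec.≡-dec Bool._≟_

p⊆q∧∣p∣≡∣q∣⇒p≡q : ∀ {m} {p q : Subset m} → p ⊆ q → ∣ p ∣ ≡ ∣ q ∣ → p ≡ q
p⊆q∧∣p∣≡∣q∣⇒p≡q {p = []}         {[]}         _   _ = refl
p⊆q∧∣p∣≡∣q∣⇒p≡q {p = true ∷ p}   {true ∷ q}   p⊆q e =
  cong (true ∷_) (p⊆q∧∣p∣≡∣q∣⇒p≡q (drop-∷-⊆ p⊆q) (suc-injective e))
p⊆q∧∣p∣≡∣q∣⇒p≡q {p = false ∷ p}  {false ∷ q}  p⊆q e =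
  cong (false ∷_) (p⊆q∧∣p∣≡∣q∣⇒p≡q (drop-∷-⊆ p⊆q) e)
p⊆q∧∣p∣≡∣q∣⇒p≡q {p = true ∷ p}   {false ∷ q}  p⊆q _ = contradiction (p⊆q here) λ ()
p⊆q∧∣p∣≡∣q∣⇒p≡q {p = false ∷ p}  {true ∷ q}   p⊆q e =
  contradiction (subst (_≤ ∣ q ∣) e (p⊆q⇒∣p∣≤∣q∣ (drop-∷-⊆ p⊆q))) 1+n≰n

p⊆q∧p≢q⇒∣p∣<∣q∣ : ∀ {m} {p q : Subset m} → p ⊆ q → ¬ p ≡ q → ∣ p ∣ < ∣ q ∣
p⊆q∧p≢q⇒∣p∣<∣q∣ p⊆q p≢q = ≤∧≢⇒< (p⊆q⇒∣p∣≤∣q∣ p⊆q) (p≢q ∘′ p⊆q∧∣p∣≡∣q∣⇒p≡q p⊆q)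

-- Leads c B A: reading B and A from the left, B has so far c more elements than A
-- and has never had fewer.  B ≼ A iff Leads 0 B A.
Leads : ∀ {m} → ℕ → Subset m → Subset m → Set
Leads c       []          []          = c ≡ 0
Leads c       (true ∷ B)  (true ∷ A)  = Leads c B A
Leads c       (true ∷ B)  (false ∷ A) = Leads (suc c) B A
Leads c       (false ∷ B) (false ∷ A) = Leads c B A
Leads zero    (false ∷ B) (true ∷ A)  = ⊥
Leads (suc c) (false ∷ B) (true ∷ A)  = Leads c B A

Leads-size : ∀ {m} c (B A : Subset m) → Leads c B A → c + ∣ B ∣ ≡ ∣ A ∣
Leads-size c       []          []          c≡0 = trans (+-identityʳ c) c≡0
Leads-size c       (true ∷ B)  (true ∷ A)  l   = trans (+-suc c _) (cong suc (Leads-size c B A l))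
Leads-size c       (true ∷ B)  (false ∷ A) l   = trans (+-suc c _) (Leads-size (suc c) B A l)
Leads-size c       (false ∷ B) (false ∷ A) l   = Leads-size c B A l
Leads-size (suc c) (false ∷ B) (true ∷ A)  l   = cong suc (Leads-size c B A l)

Leads-⊤ : ∀ {m} e (A : Subset m) → e + ∣ A ∣ ≡ m → Leads e A ⊤
Leads-⊤ e       []          e≡0 = trans (sym (+-identityʳ e)) e≡0
Leads-⊤ e       (true ∷ A)  eq  = Leads-⊤ e A (suc-injective (trans (sym (+-suc e _)) eq))
Leads-⊤ (suc e) (false ∷ A) eq  = Leads-⊤ e A (suc-injective eq)
Leads-⊤ zero    (false ∷ A) eq  = contradiction (subst (_≤ _) eq (∣p∣≤n A)) 1+n≰n

elementsFrom : ∀ {m} → ℕ → Subset m → List ℕ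
elementsFrom k []          = []
elementsFrom k (true ∷ p)  = k ∷ elementsFrom (suc k) p
elementsFrom k (false ∷ p) = elementsFrom (suc k) p

elementsFrom-suc : ∀ {m} k (p : Subset m) → elementsFrom (suc k) p ≡ map suc (elementsFrom k p)
elementsFrom-suc k []          = refl
elementsFrom-suc k (true ∷ p)  = cong (suc k ∷_) (elementsFrom-suc (suc k) p)
elementsFrom-suc k (false ∷ p) = elementsFrom-suc (suc k) p

map-toℕ-elems     : ∀ {m} (p : Subset m) → map toℕ (elems p) ≡ elementsFrom 0 p
map-toℕ-elems-suc : ∀ {m} (p : Subset m) → map toℕ (map fsuc (elems p)) ≡ elementsFrom 1 p

map-toℕ-elems []          = refl
map-toℕ-elems (true ∷ p)  = cong (0 ∷_) (map-toℕ-elems-suc p)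
map-toℕ-elems (false ∷ p) = map-toℕ-elems-suc p

map-toℕ-elems-suc p = begin
  map toℕ (map fsuc (elems p)) ≡⟨ map-∘ (elems p) ⟨
  map (suc ∘′ toℕ) (elems p)   ≡⟨ map-∘ (elems p) ⟩
  map suc (map toℕ (elems p))  ≡⟨ cong (map suc) (map-toℕ-elems p) ⟩
  map suc (elementsFrom 0 p)   ≡⟨ elementsFrom-suc 0 p ⟨
  elementsFrom 1 p             ∎
  where open ≡-Reasoning

infix 4 _≤*_
_≤*_ : List ℕ → List ℕ → Set
_≤*_ = Pointwise _≤_

length-∷ʳ : ∀ (Q : List ℕ) k → length (Q ++ [ k ]) ≡ suc (length Q)
length-∷ʳ Q k = trans (length-++ Q) (+-comm (length Q) 1)

-- Q is the queue of elements of B already read but not yet matched; each element of A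
-- is matched with the oldest element of the queue.
Leads⇒≤*         : ∀ {m} k Q (B A : Subset m) → All (_≤ k) Q → Leads (length Q) B A →
                   Q ++ elementsFrom k B ≤* elementsFrom k A
Leads-enqueue⇒≤* : ∀ {m} k Q (B A : Subset m) → All (_≤ k) Q → Leads (suc (length Q)) B A →
                   Q ++ k ∷ elementsFrom (suc k) B ≤* elementsFrom (suc k) A

Leads⇒≤* k []      []          []          _           _ = []
Leads⇒≤* k (q ∷ Q) []          []          _           ()
Leads⇒≤* k []      (true ∷ B)  (true ∷ A)  _           l = ≤-refl ∷ Leads⇒≤* (suc k) [] B A [] l
Leads⇒≤* k (q ∷ Q) (true ∷ B)  (true ∷ A)  (q≤k ∷ Q≤k) l = q≤k ∷ Leads-enqueue⇒≤* k Q B A Q≤k l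
Leads⇒≤* k Q       (true ∷ B)  (false ∷ A) Q≤k         l = Leads-enqueue⇒≤* k Q B A Q≤k l
Leads⇒≤* k Q       (false ∷ B) (false ∷ A) Q≤k         l =
  Leads⇒≤* (suc k) Q B A (All.map m≤n⇒m≤1+n Q≤k) l
Leads⇒≤* k (q ∷ Q) (false ∷ B) (true ∷ A)  (q≤k ∷ Q≤k) l =
  q≤k ∷ Leads⇒≤* (suc k) Q B A (All.map m≤n⇒m≤1+n Q≤k) l

Leads-enqueue⇒≤* k Q B A Q≤k l =
  subst (_≤* elementsFrom (suc k) A) (++-assoc Q [ k ] _)
    (Leads⇒≤* (suc k) (Q ++ [ k ]) B A (++⁺ (All.map m≤n⇒m≤1+n Q≤k) (n≤1+n k ∷ []))
      (subst (λ c → Leads c B A) (sym (length-∷ʳ Q k)) l))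

elementsFrom-≰ : ∀ {m} {j k} (B : Subset m) {xs} → k < j → ¬ elementsFrom j B ≤* k ∷ xs
elementsFrom-≰ (true ∷ B)  k<j (j≤k ∷ _) = <⇒≱ k<j j≤k
elementsFrom-≰ (false ∷ B) k<j le        = elementsFrom-≰ B (m≤n⇒m≤1+n k<j) le

≤*⇒Leads         : ∀ {m} k Q (B A : Subset m) →
                   Q ++ elementsFrom k B ≤* elementsFrom k A → Leads (length Q) B A
≤*-enqueue⇒Leads : ∀ {m} k Q (B A : Subset m) →
                   Q ++ k ∷ elementsFrom (suc k) B ≤* elementsFrom (suc k) A →
                   Leads (suc (length Q)) B A

≤*⇒Leads k []      []          []          _        = refl
≤*⇒Leads k []      (true ∷ B)  (true ∷ A)  (_ ∷ le) = ≤*⇒Leads (suc k) [] B A le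
≤*⇒Leads k (q ∷ Q) (true ∷ B)  (true ∷ A)  (_ ∷ le) = ≤*-enqueue⇒Leads k Q B A le
≤*⇒Leads k Q       (true ∷ B)  (false ∷ A) le       = ≤*-enqueue⇒Leads k Q B A le
≤*⇒Leads k Q       (false ∷ B) (false ∷ A) le       = ≤*⇒Leads (suc k) Q B A le
≤*⇒Leads k []      (false ∷ B) (true ∷ A)  le       = contradiction le (elementsFrom-≰ B ≤-refl)
≤*⇒Leads k (q ∷ Q) (false ∷ B) (true ∷ A)  (_ ∷ le) = ≤*⇒Leads (suc k) Q B A le

≤*-enqueue⇒Leads k Q B A le =
  subst (λ c → Leads c B A) (length-∷ʳ Q k)
    (≤*⇒Leads (suc k) (Q ++ [ k ]) B A
      (subst (_≤* elementsFrom (suc k) A) (sym (++-assoc Q [ k ] _)) le))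

≼⇒Leads : ∀ {m} (B A : Subset m) → B ≼ A → Leads 0 B A
≼⇒Leads B A B≼A =
  ≤*⇒Leads 0 [] B A (subst₂ _≤*_ (map-toℕ-elems B) (map-toℕ-elems A) (map⁺ toℕ toℕ B≼A))

Leads⇒≼ : ∀ {m} (B A : Subset m) → Leads 0 B A → B ≼ A
Leads⇒≼ B A l =
  map⁻ toℕ toℕ (subst₂ _≤*_ (sym (map-toℕ-elems B)) (sym (map-toℕ-elems A)) (Leads⇒≤* 0 [] B A [] l))

≼⇒∣∣≡ : ∀ {m} (B A : Subset m) → B ≼ A → ∣ B ∣ ≡ ∣ A ∣
≼⇒∣∣≡ B A B≼A = Leads-size 0 B A (≼⇒Leads B A B≼A)

-- e is the number of elements of A read so far that A′ has not yet matched.  A′ takes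
-- every element of G and otherwise skips positions while A can still be caught up
-- (e + ∣ A ∣ ≤ m), after which it takes everything; c ≤ e because A ⊇ B.
Leads-cover : ∀ {m} c e (B G A : Subset m) → Leads c B G → B ⊆ A → c ≤ e → e + ∣ A ∣ ≤ m →
              ∃[ A′ ] G ⊆ A′ × Leads e A A′
Leads-cover c e [] [] [] _ _ _ room = [] , (λ ()) , n≤0⇒n≡0 (subst (_≤ 0) (+-identityʳ e) room)
Leads-cover c e (true ∷ B) G (false ∷ A) _ B⊆A _ _ = contradiction (B⊆A here) λ ()
Leads-cover zero e (false ∷ B) (true ∷ G) A () _ _ _
Leads-cover {suc m} c e (true ∷ B) (true ∷ G) (true ∷ A) l B⊆A c≤e room =
  let A′ , G⊆A′ , l′ = Leads-cover c e B G A l (drop-∷-⊆ B⊆A) c≤e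
                                   (s≤s⁻¹ (subst (_≤ suc m) (+-suc e ∣ A ∣) room))
  in true ∷ A′ , in⊆in G⊆A′ , l′
Leads-cover {suc m} (suc c) e (false ∷ B) (true ∷ G) (true ∷ A) l B⊆A c≤e room =
  let A′ , G⊆A′ , l′ = Leads-cover c e B G A l (drop-∷-⊆ B⊆A) (≤-trans (n≤1+n c) c≤e)
                                   (s≤s⁻¹ (subst (_≤ suc m) (+-suc e ∣ A ∣) room))
  in true ∷ A′ , in⊆in G⊆A′ , l′
Leads-cover (suc c) (suc e) (false ∷ B) (true ∷ G) (false ∷ A) l B⊆A (s≤s c≤e) (s≤s room) =
  let A′ , G⊆A′ , l′ = Leads-cover c e B G A l (drop-∷-⊆ B⊆A) c≤e room
  in true ∷ A′ , in⊆in G⊆A′ , l′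
Leads-cover {suc m} c e (b ∷ B) (false ∷ G) (a ∷ A) l B⊆A c≤e room with e + ∣ a ∷ A ∣ ≤? m
... | no tight = ⊤ , ⊆⊤ , Leads-⊤ e (a ∷ A) (≤-antisym room (≰⇒> tight))
Leads-cover {suc m} c e (true ∷ B) (false ∷ G) (true ∷ A) l B⊆A c≤e room | yes room′ =
  let A′ , G⊆A′ , l′ = Leads-cover (suc c) (suc e) B G A l (drop-∷-⊆ B⊆A) (s≤s c≤e)
                                   (subst (_≤ m) (+-suc e ∣ A ∣) room′)
  in false ∷ A′ , out⊆ G⊆A′ , l′
Leads-cover {suc m} c e (false ∷ B) (false ∷ G) (true ∷ A) l B⊆A c≤e room | yes room′ =
  let A′ , G⊆A′ , l′ = Leads-cover c (suc e) B G A l (drop-∷-⊆ B⊆A) (m≤n⇒m≤1+n c≤e)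
                                   (subst (_≤ m) (+-suc e ∣ A ∣) room′)
  in false ∷ A′ , out⊆ G⊆A′ , l′
Leads-cover c e (false ∷ B) (false ∷ G) (false ∷ A) l B⊆A c≤e room | yes room′ =
  let A′ , G⊆A′ , l′ = Leads-cover c e B G A l (drop-∷-⊆ B⊆A) c≤e room′
  in false ∷ A′ , out⊆ G⊆A′ , l′
Leads-cover c e (true ∷ B) (false ∷ G) (false ∷ A) l B⊆A c≤e room | yes _ = contradiction (B⊆A here) λ ()

≼-cover : ∀ {m} (B G A : Subset m) → B ≼ G → B ⊆ A → ∃[ A′ ] G ⊆ A′ × A ≼ A′
≼-cover B G A B≼G B⊆A =
  let A′ , G⊆A′ , l = Leads-cover 0 0 B G A (≼⇒Leads B G B≼G) B⊆A z≤n (∣p∣≤n A)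
  in A′ , G⊆A′ , Leads⇒≼ A A′ l

PotentialGenerator-≼ : ∀ {n r} {𝒜 : Family n} → LeftCompressed 𝒜 →
                       ∀ G B → PotentialGenerator r 𝒜 G → B ≼ G → PotentialGenerator r 𝒜 B
PotentialGenerator-≼ compressed G B potG B≼G A ∣A∣≡r B⊆A =
  let A′ , G⊆A′ , A≼A′ = ≼-cover B G A B≼G B⊆A
      ∣A′∣≡r          = trans (sym (≼⇒∣∣≡ A A′ A≼A′)) ∣A∣≡r
  in compressed A′ A (potG A′ ∣A′∣≡r G⊆A′) A≼A′

module _ {m} (P : Subset m → Set) where

  ⊆-Minimal : Subset m → Set
  ⊆-Minimal G = P G × (∀ H → H ⊆ G → P H → H ≡ G)

  ⊆-minimal-size-bound : ∀ {k} → (∀ G → ⊆-Minimal G → k ≤ ∣ G ∣) → ∀ G → P G → k ≤ ∣ G ∣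
  ⊆-minimal-size-bound {k} bound G = go G (wellFounded ∣_∣ <-wellFounded G)
    where
    go : ∀ G → Acc (_<_ on ∣_∣) G → P G → k ≤ ∣ G ∣
    go G (acc smaller) PG = ≮⇒≥ λ ∣G∣<k → <⇒≱ ∣G∣<k (bound G (PG , minimal ∣G∣<k))
      where
      minimal : ∣ G ∣ < k → ∀ H → H ⊆ G → P H → H ≡ G
      minimal ∣G∣<k H H⊆G PH = decidable-stable (H ≟ G) λ H≢G →
        let ∣H∣<∣G∣ = p⊆q∧p≢q⇒∣p∣<∣q∣ H⊆G H≢G
        in <⇒≱ (<-trans ∣H∣<∣G∣ ∣G∣<k) (go H (smaller ∣H∣<∣G∣) PH)

  size-minimal⇒⊆-minimal : ∀ {B} → P B → (∀ H → P H → ∣ B ∣ ≤ ∣ H ∣) → ⊆-Minimal B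
  size-minimal⇒⊆-minimal PB least =
    PB , λ H H⊆B PH → p⊆q∧∣p∣≡∣q∣⇒p≡q H⊆B (≤-antisym (p⊆q⇒∣p∣≤∣q∣ H⊆B) (least H PH))

lemma2p4 : (n r : ℕ) → 2 * r ≤ n → (𝒜 : Family n) → MLCIF r 𝒜 →
    (k : ℕ) → IsRank r 𝒜 k →
    LeftCompressedP (λ G → Generator r 𝒜 G × ∣ G ∣ ≡ k)
lemma2p4 n r _ 𝒜 ((_ , compressed , _) , _) k (_ , rank-least) G B ((potG , _) , ∣G∣≡k) B≼G =
  size-minimal⇒⊆-minimal (PotentialGenerator r 𝒜) potB k≤potential , ∣B∣≡k
  where
  potB : PotentialGenerator r 𝒜 B
  potB = PotentialGenerator-≼ compressed G B potG B≼G

  ∣B∣≡k : ∣ B ∣ ≡ k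
  ∣B∣≡k = trans (≼⇒∣∣≡ B G B≼G) ∣G∣≡k

  k≤potential : ∀ H → PotentialGenerator r 𝒜 H → ∣ B ∣ ≤ ∣ H ∣
  k≤potential H potH =
    subst (_≤ ∣ H ∣) (sym ∣B∣≡k) (⊆-minimal-size-bound (PotentialGenerator r 𝒜) rank-least H potH)
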